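{- Let $K$ be an algebraically closed field of characteristic $0$, let $f,g\in K[t]$ be relatively prime polynomials, and let $(A,B,C)$ be either $(f^2-g^2,\,2fg,\,f^2+g^2)$ or $(2fg,\,f^2-g^2,\,f^2+g^2)$. Let $w\in K[t]$ be a nonzero polynomial. If $A$ is nonconstant of even degree, then $wA+(wB)^2\neq (wC)^3$. If $C$ is nonconstant of even degree, then $(wA)^2+(wB)^3\neq wC$. -}

module Defs where

open import Level using (_⊔_)
open import Algebra.Bundles using (CommutativeRing)
open import Data.Nat using (ℕ; zero; suc; _<_; _≤_) renaming (_*_ to _*ℕ_)
open import Data.List using (List; []; _∷_)
open import Data.Product using (Σ; ∃; _×_; _,_)
open import Data.Bool using (Bool; true; false)
open import Relation.Nullary using (¬_)
open import Relation.Binary.PropositionalEquality using (_≡_)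

-- Polynomials in one variable t over a commutative ring R, represented as
-- coefficient lists (constant coefficient first). Equality of polynomials is
-- coefficientwise (setoid) equality, so trailing zeros are irrelevant.
module PolyOver {c ℓ} (R : CommutativeRing c ℓ) where
  open CommutativeRing R renaming (Carrier to K)

  Poly : Set c
  Poly = List K

  coeff : Poly → ℕ → K
  coeff []       _       = 0#
  coeff (a ∷ p)  zero    = a
  coeff (a ∷ p)  (suc n) = coeff p n

  infix 4 _≈ₚ_
  _≈ₚ_ : Poly → Poly → Set ℓ
  p ≈ₚ q = ∀ n → coeff p n ≈ coeff q n

  0ₚ : Poly
  0ₚ = []

  1ₚ : Poly
  1ₚ = 1# ∷ []

  constₚ : K → Poly
  constₚ a = a ∷ []

  infixl 6 _+ₚ_ _-ₚ_
  infixl 7 _*ₚ_ _·ₚ_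
  infixr 8 _^ₚ_

  _+ₚ_ : Poly → Poly → Poly
  []      +ₚ q       = q
  (a ∷ p) +ₚ []      = a ∷ p
  (a ∷ p) +ₚ (b ∷ q) = (a + b) ∷ (p +ₚ q)

  _·ₚ_ : K → Poly → Poly
  a ·ₚ []      = []
  a ·ₚ (b ∷ p) = (a * b) ∷ (a ·ₚ p)

  -ₚ_ : Poly → Poly
  -ₚ p = (- 1#) ·ₚ p

  _-ₚ_ : Poly → Poly → Poly
  p -ₚ q = p +ₚ (-ₚ q)

  _*ₚ_ : Poly → Poly → Poly
  []      *ₚ q = []
  (a ∷ p) *ₚ q = (a ·ₚ q) +ₚ (0# ∷ (p *ₚ q))

  _^ₚ_ : Poly → ℕ → Poly
  p ^ₚ zero  = 1ₚ
  p ^ₚ suc n = p *ₚ (p ^ₚ n)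

  eval : Poly → K → K
  eval []      x = 0#
  eval (a ∷ p) x = a + x * eval p x

  HasDegree : Poly → ℕ → Set ℓ
  HasDegree p d = ¬ (coeff p d ≈ 0#) × (∀ n → d < n → coeff p n ≈ 0#)

  Nonconstant : Poly → Set ℓ
  Nonconstant p = ∃ λ d → HasDegree p d × 1 ≤ d

  NonconstantEvenDegree : Poly → Set ℓ
  NonconstantEvenDegree p = ∃ λ d → HasDegree p d × 1 ≤ d × (∃ λ k → d ≡ 2 *ℕ k)

  infix 4 _∣ₚ_
  _∣ₚ_ : Poly → Poly → Set (c ⊔ ℓ)
  d ∣ₚ p = ∃ λ q → p ≈ₚ q *ₚ d

  RelativelyPrime : Poly → Poly → Set (c ⊔ ℓ)
  RelativelyPrime f g = ∀ d → d ∣ₚ f → d ∣ₚ g → d ∣ₚ 1ₚ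

  two : K
  two = 1# + 1#

  triple : Bool → Poly → Poly → Poly × Poly × Poly
  triple false f g = (f ^ₚ 2 -ₚ g ^ₚ 2) , (two ·ₚ (f *ₚ g)) , (f ^ₚ 2 +ₚ g ^ₚ 2)
  triple true  f g = (two ·ₚ (f *ₚ g)) , (f ^ₚ 2 -ₚ g ^ₚ 2) , (f ^ₚ 2 +ₚ g ^ₚ 2)

IsField : ∀ {c ℓ} → CommutativeRing c ℓ → Set (c ⊔ ℓ)
IsField R = ¬ (1# ≈ 0#) × (∀ x → ¬ (x ≈ 0#) → ∃ λ y → x * y ≈ 1#)
  where open CommutativeRing R

fromℕ : ∀ {c ℓ} (R : CommutativeRing c ℓ) → ℕ → CommutativeRing.Carrier R
fromℕ R zero    = CommutativeRing.0# R
fromℕ R (suc n) = CommutativeRing._+_ R (CommutativeRing.1# R) (fromℕ R n)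

CharZero : ∀ {c ℓ} → CommutativeRing c ℓ → Set ℓ
CharZero R = ∀ n → ¬ (fromℕ R (suc n) ≈ 0#)
  where open CommutativeRing R

AlgClosed : ∀ {c ℓ} → CommutativeRing c ℓ → Set (c ⊔ ℓ)
AlgClosed R = ∀ p → Nonconstant p → ∃ λ x → eval p x ≈ 0#
  where open CommutativeRing R
        open PolyOver R

{-# OPTIONS --safe #-}
module Submission where

-- Writing u = wA, v = wC in the first equation and u = wC, v = wB in the second, the identity
-- A² + B² = C² turns either equation into u² − u = v² − v³, a point of an elliptic curve;
-- equivalently (2u − 1)² = S(v) with S = 1 + 4v² − 4v³.  Comparing degrees gives
-- 2 deg u = 3 deg v, so v is nonconstant.  Since S is squarefree, differentiating
-- (2u − 1)² = S(v) shows that 2u − 1 divides 43·v′, which is impossible as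
-- deg v′ < deg v < deg u.

import Data.Integer.Properties as ℤ
import Data.Nat.Properties as ℕ
import Relation.Binary.Reasoning.Setoid as SetoidReasoning
open import Algebra.Bundles using (CommutativeRing; RawRing)
open import Data.Bool using (Bool; false; true)
open import Data.Empty using (⊥-elim)
open import Data.Integer as ℤ using (ℤ; +_; -[1+_]; _⊖_; sign; ∣_∣)
open import Data.List using ([]; _∷_; length)
open import Data.Maybe as Maybe using (Maybe)
open import Data.Nat as ℕ using (ℕ; zero; suc; z≤n; s≤s; _<_; _≤_)
open import Data.Product using (_×_; _,_; proj₁; proj₂; ∃)
open import Data.Sign as Sign using (Sign)
open import Data.Sum using (inj₁; inj₂)
open import Defs
open import Level using (_⊔_)
open import Relation.Binary.Consequences using (dec⇒weaklyDec)
open import Relation.Binary.Definitions using (tri<; tri≈; tri>)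
open import Relation.Binary.PropositionalEquality as ≡ using (_≡_)
open import Relation.Binary.Structures using (IsEquivalence)
open import Relation.Nullary using (¬_; Dec; yes; no; ¬¬-excluded-middle)
open import Relation.Nullary.Decidable using (decidable-stable)
open import Relation.Nullary.Negation using (DoubleNegation)

module IntegerSolver {c ℓ} (R : CommutativeRing c ℓ) where
  open CommutativeRing R
  open import Algebra.Properties.Ring ring using (-‿distribˡ-*; -‿distribʳ-*)
  open import Algebra.Properties.AbelianGroup +-abelianGroup
    using (⁻¹-∙-comm) renaming (ε⁻¹≈ε to -0#≈0#; ⁻¹-involutive to -‿involutive)
  open import Algebra.Properties.Semiring.Mult semiring using (×1-homo-*; ×-homo-+) renaming (_×_ to _×ₙ_)
  import Algebra.Solver.Ring.AlmostCommutativeRing as ACR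
  open import Relation.Binary.Reasoning.Setoid setoid

  signed : Sign → Carrier → Carrier
  signed Sign.+ x = x
  signed Sign.- x = - x

  signed-cong : ∀ s {x y} → x ≈ y → signed s x ≈ signed s y
  signed-cong Sign.+ x≈y = x≈y
  signed-cong Sign.- x≈y = -‿cong x≈y

  signed-0# : ∀ s → signed s 0# ≈ 0#
  signed-0# Sign.+ = refl
  signed-0# Sign.- = -0#≈0#

  signed-* : ∀ s t x y → signed (s Sign.* t) (x * y) ≈ signed s x * signed t y
  signed-* Sign.+ Sign.+ x y = refl
  signed-* Sign.+ Sign.- x y = -‿distribʳ-* x y
  signed-* Sign.- Sign.+ x y = -‿distribˡ-* x y
  signed-* Sign.- Sign.- x y = begin
    x * y               ≈⟨ *-cong (-‿involutive x) (-‿involutive y) ⟨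
    - (- x) * - (- y)   ≈⟨ -‿distribˡ-* (- x) (- (- y)) ⟨
    - (- x * - (- y))   ≈⟨ -‿cong (-‿distribʳ-* (- x) (- y)) ⟨
    - (- (- x * - y))   ≈⟨ -‿involutive _ ⟩
    - x * - y           ∎

  ⟦_⟧ℤ : ℤ → Carrier
  ⟦ i ⟧ℤ = signed (sign i) (∣ i ∣ ×ₙ 1#)

  ⟦◃⟧ℤ : ∀ s n → ⟦ s ℤ.◃ n ⟧ℤ ≈ signed s (n ×ₙ 1#)
  ⟦◃⟧ℤ s      zero    = sym (signed-0# s)
  ⟦◃⟧ℤ Sign.+ (suc n) = refl
  ⟦◃⟧ℤ Sign.- (suc n) = refl

  ⟦⊖⟧ℤ : ∀ m n → ⟦ m ⊖ n ⟧ℤ ≈ m ×ₙ 1# - n ×ₙ 1#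
  ⟦⊖⟧ℤ m zero = begin
    ⟦ m ⊖ 0 ⟧ℤ    ≡⟨ ≡.cong ⟦_⟧ℤ (ℤ.⊖-≥ {m} {0} z≤n) ⟩
    m ×ₙ 1#        ≈⟨ +-identityʳ _ ⟨
    m ×ₙ 1# + 0#   ≈⟨ +-congˡ -0#≈0# ⟨
    m ×ₙ 1# - 0#   ∎
  ⟦⊖⟧ℤ zero (suc n) = begin
    ⟦ 0 ⊖ suc n ⟧ℤ      ≡⟨ ≡.cong ⟦_⟧ℤ (ℤ.⊖-< {0} {suc n} (s≤s z≤n)) ⟩
    - (suc n ×ₙ 1#)      ≈⟨ +-identityˡ _ ⟨
    0# - suc n ×ₙ 1#     ∎
  ⟦⊖⟧ℤ (suc m) (suc n) = begin
    ⟦ suc m ⊖ suc n ⟧ℤ           ≡⟨ ≡.cong ⟦_⟧ℤ (ℤ.[1+m]⊖[1+n]≡m⊖n m n) ⟩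
    ⟦ m ⊖ n ⟧ℤ                   ≈⟨ ⟦⊖⟧ℤ m n ⟩
    m ×ₙ 1# - n ×ₙ 1#              ≈⟨ +-congˡ (+-identityˡ _) ⟨
    m ×ₙ 1# + (0# - n ×ₙ 1#)       ≈⟨ +-congˡ (+-congʳ (-‿inverseʳ 1#)) ⟨
    m ×ₙ 1# + ((1# - 1#) - n ×ₙ 1#) ≈⟨ +-congˡ (+-assoc 1# (- 1#) _) ⟩
    m ×ₙ 1# + (1# + (- 1# - n ×ₙ 1#)) ≈⟨ +-assoc _ 1# _ ⟨
    (m ×ₙ 1# + 1#) + (- 1# - n ×ₙ 1#) ≈⟨ +-cong (+-comm _ 1#) (⁻¹-∙-comm 1# _) ⟩
    suc m ×ₙ 1# - suc n ×ₙ 1#      ∎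

  ⟦+⟧ℤ : ∀ i j → ⟦ i ℤ.+ j ⟧ℤ ≈ ⟦ i ⟧ℤ + ⟦ j ⟧ℤ
  ⟦+⟧ℤ -[1+ m ] -[1+ n ] = begin
    - (suc (suc (m ℕ.+ n)) ×ₙ 1#)        ≡⟨ ≡.cong (λ k → - (suc k ×ₙ 1#)) (ℕ.+-suc m n) ⟨
    - ((suc m ℕ.+ suc n) ×ₙ 1#)          ≈⟨ -‿cong (×-homo-+ 1# (suc m) (suc n)) ⟩
    - (suc m ×ₙ 1# + suc n ×ₙ 1#)         ≈⟨ ⁻¹-∙-comm _ _ ⟨
    - (suc m ×ₙ 1#) - suc n ×ₙ 1#         ∎
  ⟦+⟧ℤ -[1+ m ] (+ n)    = trans (⟦⊖⟧ℤ n (suc m)) (+-comm _ _)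
  ⟦+⟧ℤ (+ m)    -[1+ n ] = ⟦⊖⟧ℤ m (suc n)
  ⟦+⟧ℤ (+ m)    (+ n)    = ×-homo-+ 1# m n

  ⟦*⟧ℤ : ∀ i j → ⟦ i ℤ.* j ⟧ℤ ≈ ⟦ i ⟧ℤ * ⟦ j ⟧ℤ
  ⟦*⟧ℤ i j = begin
    ⟦ i ℤ.* j ⟧ℤ                                         ≈⟨ ⟦◃⟧ℤ (sign i Sign.* sign j) (∣ i ∣ ℕ.* ∣ j ∣) ⟩
    signed (sign i Sign.* sign j) ((∣ i ∣ ℕ.* ∣ j ∣) ×ₙ 1#) ≈⟨ signed-cong (sign i Sign.* sign j) (×1-homo-* ∣ i ∣ ∣ j ∣) ⟩
    signed (sign i Sign.* sign j) (∣ i ∣ ×ₙ 1# * ∣ j ∣ ×ₙ 1#) ≈⟨ signed-* (sign i) (sign j) _ _ ⟩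
    ⟦ i ⟧ℤ * ⟦ j ⟧ℤ                                      ∎

  ⟦-⟧ℤ : ∀ i → ⟦ ℤ.- i ⟧ℤ ≈ - ⟦ i ⟧ℤ
  ⟦-⟧ℤ -[1+ n ]  = sym (-‿involutive _)
  ⟦-⟧ℤ (+ zero)  = sym -0#≈0#
  ⟦-⟧ℤ (+ suc n) = refl

  ℤ-rawRing : RawRing _ _
  ℤ-rawRing = record
    { Carrier = ℤ ; _≈_ = _≡_ ; _+_ = ℤ._+_ ; _*_ = ℤ._*_ ; -_ = ℤ.-_ ; 0# = ℤ.0ℤ ; 1# = ℤ.1ℤ }

  ℤ⟶R : ℤ-rawRing ACR.-Raw-AlmostCommutative⟶ ACR.fromCommutativeRing R
  ℤ⟶R = record
    { ⟦_⟧ = ⟦_⟧ℤ ; +-homo = ⟦+⟧ℤ ; *-homo = ⟦*⟧ℤ ; -‿homo = ⟦-⟧ℤ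
    ; 0-homo = refl ; 1-homo = +-identityʳ 1# }

  ⟦⟧ℤ-≟ : ∀ i j → Maybe (⟦ i ⟧ℤ ≈ ⟦ j ⟧ℤ)
  ⟦⟧ℤ-≟ i j = Maybe.map (λ { ≡.refl → refl }) (dec⇒weaklyDec ℤ._≟_ i j)

  open import Algebra.Solver.Ring ℤ-rawRing (ACR.fromCommutativeRing R) ℤ⟶R ⟦⟧ℤ-≟ public

module PythagoreanReduction {c ℓ} (R : CommutativeRing c ℓ) where
  open CommutativeRing R
  open IntegerSolver R using (solve; _:=_; _:+_; _:*_; _:-_)
  open import Relation.Binary.Reasoning.Setoid setoid

  OnCurve : Carrier → Carrier → Set ℓ
  OnCurve u v = u * u - u ≈ v * v - v * v * v

  onCurve-from-first : ∀ w A B C → A * A + B * B ≈ C * C →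
    w * A + (w * B) * (w * B) ≈ (w * C) * ((w * C) * (w * C)) → OnCurve (w * A) (w * C)
  onCurve-from-first w A B C pythagorean eq = begin
    (w * A) * (w * A) - w * A
      ≈⟨ solve 3 (λ w A B → (w :* A) :* (w :* A) :- w :* A :=
                             (w :* w) :* (A :* A :+ B :* B) :- (w :* A :+ (w :* B) :* (w :* B))) refl w A B ⟩
    (w * w) * (A * A + B * B) - (w * A + (w * B) * (w * B))
      ≈⟨ +-cong (*-congˡ pythagorean) (-‿cong eq) ⟩
    (w * w) * (C * C) - (w * C) * ((w * C) * (w * C))
      ≈⟨ solve 2 (λ w C → (w :* w) :* (C :* C) :- (w :* C) :* ((w :* C) :* (w :* C)) :=
                           (w :* C) :* (w :* C) :- (w :* C) :* (w :* C) :* (w :* C)) refl w C ⟩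
    (w * C) * (w * C) - (w * C) * (w * C) * (w * C) ∎

  onCurve-from-second : ∀ w A B C → A * A + B * B ≈ C * C →
    (w * A) * (w * A) + (w * B) * ((w * B) * (w * B)) ≈ w * C → OnCurve (w * C) (w * B)
  onCurve-from-second w A B C pythagorean eq = begin
    (w * C) * (w * C) - w * C
      ≈⟨ +-congˡ (-‿cong eq) ⟨
    (w * C) * (w * C) - ((w * A) * (w * A) + (w * B) * ((w * B) * (w * B)))
      ≈⟨ solve 4 (λ w A B C → (w :* C) :* (w :* C) :- ((w :* A) :* (w :* A) :+ (w :* B) :* ((w :* B) :* (w :* B))) :=
                               (w :* w) :* (C :* C) :- (w :* w) :* (A :* A) :- (w :* B) :* ((w :* B) :* (w :* B))) refl w A B C ⟩
    (w * w) * (C * C) - (w * w) * (A * A) - (w * B) * ((w * B) * (w * B))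
      ≈⟨ +-congʳ (+-congʳ (*-congˡ pythagorean)) ⟨
    (w * w) * (A * A + B * B) - (w * w) * (A * A) - (w * B) * ((w * B) * (w * B))
      ≈⟨ solve 3 (λ w A B → (w :* w) :* (A :* A :+ B :* B) :- (w :* w) :* (A :* A) :- (w :* B) :* ((w :* B) :* (w :* B)) :=
                             (w :* B) :* (w :* B) :- (w :* B) :* (w :* B) :* (w :* B)) refl w A B ⟩
    (w * B) * (w * B) - (w * B) * (w * B) * (w * B) ∎

module Polynomial {c ℓ} (R : CommutativeRing c ℓ) where
  open CommutativeRing R renaming (Carrier to K) hiding (zero)
  open PolyOver R
  open import Algebra.Properties.Ring ring using (-1*x≈-x)
  open import Algebra.Properties.CommutativeSemigroup +-commutativeSemigroup using (interchange)
  open SetoidReasoning setoid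

  -- A record rather than ≈ₚ itself, so that both polynomials can be inferred from a proof.
  infix 4 _≋_
  record _≋_ (p q : Poly) : Set ℓ where
    constructor mk≋
    field coeff-≈ : p ≈ₚ q
  open _≋_ public

  ≋-refl : ∀ {p} → p ≋ p
  ≋-refl = mk≋ λ n → refl

  ≋-sym : ∀ {p q} → p ≋ q → q ≋ p
  ≋-sym (mk≋ e) = mk≋ λ n → sym (e n)

  ≋-trans : ∀ {p q r} → p ≋ q → q ≋ r → p ≋ r
  ≋-trans (mk≋ e) (mk≋ f) = mk≋ λ n → trans (e n) (f n)

  ≋-isEquivalence : IsEquivalence _≋_
  ≋-isEquivalence = record { refl = ≋-refl ; sym = ≋-sym ; trans = ≋-trans }

  shift : Poly → Poly
  shift p = 0# ∷ p

  coeff-+ₚ : ∀ p q n → coeff (p +ₚ q) n ≈ coeff p n + coeff q n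
  coeff-+ₚ []      q       n       = sym (+-identityˡ _)
  coeff-+ₚ (a ∷ p) []      n       = sym (+-identityʳ _)
  coeff-+ₚ (a ∷ p) (b ∷ q) zero    = refl
  coeff-+ₚ (a ∷ p) (b ∷ q) (suc n) = coeff-+ₚ p q n

  coeff-·ₚ : ∀ a p n → coeff (a ·ₚ p) n ≈ a * coeff p n
  coeff-·ₚ a []      n       = sym (zeroʳ a)
  coeff-·ₚ a (b ∷ p) zero    = refl
  coeff-·ₚ a (b ∷ p) (suc n) = coeff-·ₚ a p n

  +ₚ-cong : ∀ {p p′ q q′} → p ≋ p′ → q ≋ q′ → p +ₚ q ≋ p′ +ₚ q′
  +ₚ-cong {p} {p′} {q} {q′} (mk≋ e) (mk≋ f) = mk≋ λ n → begin
    coeff (p +ₚ q) n       ≈⟨ coeff-+ₚ p q n ⟩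
    coeff p n + coeff q n   ≈⟨ +-cong (e n) (f n) ⟩
    coeff p′ n + coeff q′ n ≈⟨ coeff-+ₚ p′ q′ n ⟨
    coeff (p′ +ₚ q′) n     ∎

  +ₚ-comm : ∀ p q → p +ₚ q ≋ q +ₚ p
  +ₚ-comm p q = mk≋ λ n → trans (coeff-+ₚ p q n) (trans (+-comm _ _) (sym (coeff-+ₚ q p n)))

  +ₚ-assoc : ∀ p q r → (p +ₚ q) +ₚ r ≋ p +ₚ (q +ₚ r)
  +ₚ-assoc p q r = mk≋ λ n → begin
    coeff ((p +ₚ q) +ₚ r) n               ≈⟨ trans (coeff-+ₚ (p +ₚ q) r n) (+-congʳ (coeff-+ₚ p q n)) ⟩
    (coeff p n + coeff q n) + coeff r n   ≈⟨ +-assoc _ _ _ ⟩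
    coeff p n + (coeff q n + coeff r n)   ≈⟨ trans (coeff-+ₚ p (q +ₚ r) n) (+-congˡ (coeff-+ₚ q r n)) ⟨
    coeff (p +ₚ (q +ₚ r)) n               ∎

  +ₚ-identityʳ : ∀ p → p +ₚ 0ₚ ≋ p
  +ₚ-identityʳ p = mk≋ λ n → trans (coeff-+ₚ p [] n) (+-identityʳ _)

  +ₚ-interchange : ∀ p q r s → (p +ₚ q) +ₚ (r +ₚ s) ≋ (p +ₚ r) +ₚ (q +ₚ s)
  +ₚ-interchange p q r s = mk≋ λ n → begin
    coeff ((p +ₚ q) +ₚ (r +ₚ s)) n                       ≈⟨ trans (coeff-+ₚ (p +ₚ q) (r +ₚ s) n) (+-cong (coeff-+ₚ p q n) (coeff-+ₚ r s n)) ⟩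
    (coeff p n + coeff q n) + (coeff r n + coeff s n)   ≈⟨ interchange _ _ _ _ ⟩
    (coeff p n + coeff r n) + (coeff q n + coeff s n)   ≈⟨ trans (coeff-+ₚ (p +ₚ r) (q +ₚ s) n) (+-cong (coeff-+ₚ p r n) (coeff-+ₚ q s n)) ⟨
    coeff ((p +ₚ r) +ₚ (q +ₚ s)) n                       ∎

  ·ₚ-cong : ∀ {a b p q} → a ≈ b → p ≋ q → a ·ₚ p ≋ b ·ₚ q
  ·ₚ-cong {a} {b} {p} {q} a≈b (mk≋ e) = mk≋ λ n →
    trans (coeff-·ₚ a p n) (trans (*-cong a≈b (e n)) (sym (coeff-·ₚ b q n)))

  ·ₚ-distribˡ : ∀ a p q → a ·ₚ (p +ₚ q) ≋ a ·ₚ p +ₚ a ·ₚ q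
  ·ₚ-distribˡ a p q = mk≋ λ n → begin
    coeff (a ·ₚ (p +ₚ q)) n             ≈⟨ trans (coeff-·ₚ a (p +ₚ q) n) (*-congˡ (coeff-+ₚ p q n)) ⟩
    a * (coeff p n + coeff q n)         ≈⟨ distribˡ a _ _ ⟩
    a * coeff p n + a * coeff q n       ≈⟨ trans (coeff-+ₚ (a ·ₚ p) (a ·ₚ q) n) (+-cong (coeff-·ₚ a p n) (coeff-·ₚ a q n)) ⟨
    coeff (a ·ₚ p +ₚ a ·ₚ q) n          ∎

  ·ₚ-distribʳ : ∀ a b p → (a + b) ·ₚ p ≋ a ·ₚ p +ₚ b ·ₚ p
  ·ₚ-distribʳ a b p = mk≋ λ n → begin
    coeff ((a + b) ·ₚ p) n              ≈⟨ coeff-·ₚ (a + b) p n ⟩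
    (a + b) * coeff p n                 ≈⟨ distribʳ _ a b ⟩
    a * coeff p n + b * coeff p n       ≈⟨ trans (coeff-+ₚ (a ·ₚ p) (b ·ₚ p) n) (+-cong (coeff-·ₚ a p n) (coeff-·ₚ b p n)) ⟨
    coeff (a ·ₚ p +ₚ b ·ₚ p) n          ∎

  ·ₚ-assoc : ∀ a b p → a ·ₚ (b ·ₚ p) ≋ (a * b) ·ₚ p
  ·ₚ-assoc a b p = mk≋ λ n → begin
    coeff (a ·ₚ (b ·ₚ p)) n   ≈⟨ trans (coeff-·ₚ a (b ·ₚ p) n) (*-congˡ (coeff-·ₚ b p n)) ⟩
    a * (b * coeff p n)       ≈⟨ *-assoc _ _ _ ⟨
    (a * b) * coeff p n       ≈⟨ coeff-·ₚ (a * b) p n ⟨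
    coeff ((a * b) ·ₚ p) n    ∎

  ·ₚ-zeroˡ : ∀ {a} p → a ≈ 0# → a ·ₚ p ≋ 0ₚ
  ·ₚ-zeroˡ {a} p a≈0 = mk≋ λ n → trans (coeff-·ₚ a p n) (trans (*-congʳ a≈0) (zeroˡ _))

  ·ₚ-identityˡ : ∀ p → 1# ·ₚ p ≋ p
  ·ₚ-identityˡ p = mk≋ λ n → trans (coeff-·ₚ 1# p n) (*-identityˡ _)

  shift-cong : ∀ {p q} → p ≋ q → shift p ≋ shift q
  shift-cong (mk≋ e) = mk≋ λ { zero → refl ; (suc n) → e n }

  shift-+ₚ : ∀ p q → shift (p +ₚ q) ≋ shift p +ₚ shift q
  shift-+ₚ p q = mk≋ λ { zero → sym (+-identityˡ 0#) ; (suc n) → refl }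

  shift-0ₚ : shift 0ₚ ≋ 0ₚ
  shift-0ₚ = mk≋ λ { zero → refl ; (suc n) → refl }

  ·ₚ-shift : ∀ a p → a ·ₚ shift p ≋ shift (a ·ₚ p)
  ·ₚ-shift a p = mk≋ λ { zero → zeroʳ a ; (suc n) → refl }

  -ₚ-cong : ∀ {p q} → p ≋ q → -ₚ p ≋ -ₚ q
  -ₚ-cong = ·ₚ-cong refl

  -ₚ-inverseʳ : ∀ p → p -ₚ p ≋ 0ₚ
  -ₚ-inverseʳ p = mk≋ λ n → begin
    coeff (p -ₚ p) n                   ≈⟨ trans (coeff-+ₚ p (-ₚ p) n) (+-congˡ (coeff-·ₚ (- 1#) p n)) ⟩
    coeff p n + - 1# * coeff p n        ≈⟨ +-congˡ (-1*x≈-x _) ⟩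
    coeff p n - coeff p n               ≈⟨ -‿inverseʳ _ ⟩
    0#                                 ∎

  -ₚ-inverseˡ : ∀ p → (-ₚ p) +ₚ p ≋ 0ₚ
  -ₚ-inverseˡ p = ≋-trans (+ₚ-comm (-ₚ p) p) (-ₚ-inverseʳ p)

  *ₚ-zeroˡ : ∀ p q → p ≋ 0ₚ → p *ₚ q ≋ 0ₚ
  *ₚ-zeroˡ []      q p≋0 = ≋-refl
  *ₚ-zeroˡ (a ∷ p) q (mk≋ e) = ≋-trans
    (+ₚ-cong (·ₚ-zeroˡ q (e zero)) (shift-cong (*ₚ-zeroˡ p q (mk≋ λ n → e (suc n)))))
    shift-0ₚ

  *ₚ-congˡ : ∀ p p′ q → p ≋ p′ → p *ₚ q ≋ p′ *ₚ q
  *ₚ-congˡ []      []       q e = ≋-refl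
  *ₚ-congˡ []      (b ∷ p′) q e = ≋-sym (*ₚ-zeroˡ (b ∷ p′) q (≋-sym e))
  *ₚ-congˡ (a ∷ p) []       q e = *ₚ-zeroˡ (a ∷ p) q e
  *ₚ-congˡ (a ∷ p) (b ∷ p′) q (mk≋ e) =
    +ₚ-cong (·ₚ-cong (e zero) ≋-refl) (shift-cong (*ₚ-congˡ p p′ q (mk≋ λ n → e (suc n))))

  *ₚ-congʳ : ∀ p {q q′} → q ≋ q′ → p *ₚ q ≋ p *ₚ q′
  *ₚ-congʳ []      e = ≋-refl
  *ₚ-congʳ (a ∷ p) e = +ₚ-cong (·ₚ-cong refl e) (shift-cong (*ₚ-congʳ p e))

  *ₚ-cong : ∀ {p p′ q q′} → p ≋ p′ → q ≋ q′ → p *ₚ q ≋ p′ *ₚ q′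
  *ₚ-cong {p} {p′} {q} e f = ≋-trans (*ₚ-congˡ p p′ q e) (*ₚ-congʳ p′ f)

  *ₚ-distribʳ : ∀ r p q → (p +ₚ q) *ₚ r ≋ p *ₚ r +ₚ q *ₚ r
  *ₚ-distribʳ r []      q       = ≋-refl
  *ₚ-distribʳ r (a ∷ p) []      = ≋-sym (+ₚ-identityʳ _)
  *ₚ-distribʳ r (a ∷ p) (b ∷ q) = ≋-trans
    (+ₚ-cong (·ₚ-distribʳ a b r) (≋-trans (shift-cong (*ₚ-distribʳ r p q)) (shift-+ₚ (p *ₚ r) (q *ₚ r))))
    (+ₚ-interchange (a ·ₚ r) (b ·ₚ r) (shift (p *ₚ r)) (shift (q *ₚ r)))

  *ₚ-distribˡ : ∀ r p q → r *ₚ (p +ₚ q) ≋ r *ₚ p +ₚ r *ₚ q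
  *ₚ-distribˡ []      p q = ≋-refl
  *ₚ-distribˡ (c ∷ r) p q = ≋-trans
    (+ₚ-cong (·ₚ-distribˡ c p q) (≋-trans (shift-cong (*ₚ-distribˡ r p q)) (shift-+ₚ (r *ₚ p) (r *ₚ q))))
    (+ₚ-interchange (c ·ₚ p) (c ·ₚ q) (shift (r *ₚ p)) (shift (r *ₚ q)))

  ·ₚ-*ₚ : ∀ a p q → (a ·ₚ p) *ₚ q ≋ a ·ₚ (p *ₚ q)
  ·ₚ-*ₚ a []      q = ≋-refl
  ·ₚ-*ₚ a (b ∷ p) q = ≋-trans
    (+ₚ-cong (≋-sym (·ₚ-assoc a b q)) (≋-trans (shift-cong (·ₚ-*ₚ a p q)) (≋-sym (·ₚ-shift a (p *ₚ q)))))
    (≋-sym (·ₚ-distribˡ a (b ·ₚ q) (shift (p *ₚ q))))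

  *ₚ-shift : ∀ p q → p *ₚ shift q ≋ shift (p *ₚ q)
  *ₚ-shift []      q = ≋-sym shift-0ₚ
  *ₚ-shift (a ∷ p) q = ≋-trans
    (+ₚ-cong (·ₚ-shift a q) (shift-cong (*ₚ-shift p q)))
    (≋-sym (shift-+ₚ (a ·ₚ q) (shift (p *ₚ q))))

  shift-*ₚ : ∀ p q → shift p *ₚ q ≋ shift (p *ₚ q)
  shift-*ₚ p q = +ₚ-cong (·ₚ-zeroˡ q refl) ≋-refl

  *ₚ-zeroʳ : ∀ p → p *ₚ 0ₚ ≋ 0ₚ
  *ₚ-zeroʳ []      = ≋-refl
  *ₚ-zeroʳ (a ∷ p) = ≋-trans (shift-cong (*ₚ-zeroʳ p)) shift-0ₚ

  *ₚ-constₚ : ∀ q a → q *ₚ constₚ a ≋ a ·ₚ q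
  *ₚ-constₚ []      a = ≋-refl
  *ₚ-constₚ (b ∷ q) a = mk≋ λ
    { zero    → trans (+-identityʳ _) (*-comm b a)
    ; (suc n) → coeff-≈ (*ₚ-constₚ q a) n }

  constₚ-+ₚ-shift : ∀ a p → constₚ a +ₚ shift p ≋ a ∷ p
  constₚ-+ₚ-shift a p = mk≋ λ { zero → +-identityʳ a ; (suc n) → refl }

  *ₚ-comm : ∀ p q → p *ₚ q ≋ q *ₚ p
  *ₚ-comm []      q = ≋-sym (*ₚ-zeroʳ q)
  *ₚ-comm (a ∷ p) q = ≋-sym (≋-trans (*ₚ-congʳ q (≋-sym (constₚ-+ₚ-shift a p)))
    (≋-trans (*ₚ-distribˡ q (constₚ a) (shift p))
      (+ₚ-cong (*ₚ-constₚ q a) (≋-trans (*ₚ-shift q p) (shift-cong (*ₚ-comm q p))))))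

  *ₚ-assoc : ∀ p q r → (p *ₚ q) *ₚ r ≋ p *ₚ (q *ₚ r)
  *ₚ-assoc []      q r = ≋-refl
  *ₚ-assoc (a ∷ p) q r = ≋-trans (*ₚ-distribʳ r (a ·ₚ q) (shift (p *ₚ q)))
    (+ₚ-cong (·ₚ-*ₚ a q r) (≋-trans (shift-*ₚ (p *ₚ q) r) (shift-cong (*ₚ-assoc p q r))))

  *ₚ-identityˡ : ∀ p → 1ₚ *ₚ p ≋ p
  *ₚ-identityˡ p = ≋-trans (+ₚ-cong (·ₚ-identityˡ p) shift-0ₚ) (+ₚ-identityʳ p)

  *ₚ-identityʳ : ∀ p → p *ₚ 1ₚ ≋ p
  *ₚ-identityʳ p = ≋-trans (*ₚ-comm p 1ₚ) (*ₚ-identityˡ p)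

  ^ₚ-2 : ∀ p → p ^ₚ 2 ≋ p *ₚ p
  ^ₚ-2 p = *ₚ-congʳ p (*ₚ-identityʳ p)

  ^ₚ-3 : ∀ p → p ^ₚ 3 ≋ p *ₚ (p *ₚ p)
  ^ₚ-3 p = *ₚ-congʳ p (^ₚ-2 p)

  polyRing : CommutativeRing c ℓ
  polyRing = record
    { Carrier = Poly ; _≈_ = _≋_ ; _+_ = _+ₚ_ ; _*_ = _*ₚ_ ; -_ = -ₚ_ ; 0# = 0ₚ ; 1# = 1ₚ
    ; isCommutativeRing = record
      { isRing = record
        { +-isAbelianGroup = record
          { isGroup = record
            { isMonoid = record
              { isSemigroup = record
                { isMagma = record { isEquivalence = ≋-isEquivalence ; ∙-cong = +ₚ-cong }
                ; assoc = +ₚ-assoc }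
              ; identity = (λ p → ≋-refl) , +ₚ-identityʳ }
            ; inverse = -ₚ-inverseˡ , -ₚ-inverseʳ
            ; ⁻¹-cong = -ₚ-cong }
          ; comm = +ₚ-comm }
        ; *-cong = *ₚ-cong
        ; *-assoc = *ₚ-assoc
        ; *-identity = *ₚ-identityˡ , *ₚ-identityʳ
        ; distrib = *ₚ-distribˡ , *ₚ-distribʳ }
      ; *-comm = *ₚ-comm } }

  module ≋-Reasoning = SetoidReasoning (CommutativeRing.setoid polyRing)
  module PolySolver = IntegerSolver polyRing

  -- Definitionally the solver's interpretation of  con (+ n).
  numeral : ℕ → Poly
  numeral n = PolySolver.⟦ + n ⟧ℤ

  numeral-*ₚ : ∀ n p → numeral n *ₚ p ≋ fromℕ R n ·ₚ p
  numeral-*ₚ zero    p = ≋-sym (·ₚ-zeroˡ p refl)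
  numeral-*ₚ (suc n) p = ≋-trans (*ₚ-distribʳ p 1ₚ (numeral n))
    (≋-trans (+ₚ-cong (≋-trans (*ₚ-identityˡ p) (≋-sym (·ₚ-identityˡ p))) (numeral-*ₚ n p))
             (≋-sym (·ₚ-distribʳ 1# (fromℕ R n) p)))

module PythagoreanTriple {c ℓ} (R : CommutativeRing c ℓ) where
  open CommutativeRing R using (1#; +-congˡ; +-identityʳ)
  open PolyOver R
  open Polynomial R
  open PolySolver using (solve; _:=_; _:+_; _:*_; _:-_; con)
  open ≋-Reasoning

  triple-pythagorean : ∀ s f g → let (A , B , C) = triple s f g in A *ₚ A +ₚ B *ₚ B ≋ C *ₚ C
  triple-pythagorean false f g = begin
    (f ^ₚ 2 -ₚ g ^ₚ 2) *ₚ (f ^ₚ 2 -ₚ g ^ₚ 2) +ₚ (two ·ₚ (f *ₚ g)) *ₚ (two ·ₚ (f *ₚ g))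
      ≈⟨ +ₚ-cong (*ₚ-cong f²-g² f²-g²) (*ₚ-cong 2fg 2fg) ⟩
    (f *ₚ f -ₚ g *ₚ g) *ₚ (f *ₚ f -ₚ g *ₚ g) +ₚ (numeral 2 *ₚ (f *ₚ g)) *ₚ (numeral 2 *ₚ (f *ₚ g))
      ≈⟨ solve 2 (λ f g → (f :* f :- g :* g) :* (f :* f :- g :* g) :+ (con (+ 2) :* (f :* g)) :* (con (+ 2) :* (f :* g))
                          := (f :* f :+ g :* g) :* (f :* f :+ g :* g)) ≋-refl f g ⟩
    (f *ₚ f +ₚ g *ₚ g) *ₚ (f *ₚ f +ₚ g *ₚ g)
      ≈⟨ *ₚ-cong f²+g² f²+g² ⟨
    (f ^ₚ 2 +ₚ g ^ₚ 2) *ₚ (f ^ₚ 2 +ₚ g ^ₚ 2) ∎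
    where
    f²-g² : f ^ₚ 2 -ₚ g ^ₚ 2 ≋ f *ₚ f -ₚ g *ₚ g
    f²-g² = +ₚ-cong (^ₚ-2 f) (-ₚ-cong (^ₚ-2 g))
    f²+g² : f ^ₚ 2 +ₚ g ^ₚ 2 ≋ f *ₚ f +ₚ g *ₚ g
    f²+g² = +ₚ-cong (^ₚ-2 f) (^ₚ-2 g)
    2fg : two ·ₚ (f *ₚ g) ≋ numeral 2 *ₚ (f *ₚ g)
    2fg = ≋-sym (≋-trans (numeral-*ₚ 2 (f *ₚ g)) (·ₚ-cong (+-congˡ (+-identityʳ 1#)) ≋-refl))
  triple-pythagorean true f g =
    ≋-trans (+ₚ-comm (two ·ₚ (f *ₚ g) *ₚ (two ·ₚ (f *ₚ g))) ((f ^ₚ 2 -ₚ g ^ₚ 2) *ₚ (f ^ₚ 2 -ₚ g ^ₚ 2)))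
            (triple-pythagorean false f g)

NoZeroDivisors : ∀ {c ℓ} → CommutativeRing c ℓ → Set (c ⊔ ℓ)
NoZeroDivisors R = ∀ {a b} → ¬ a ≈ 0# → ¬ b ≈ 0# → ¬ a * b ≈ 0#
  where open CommutativeRing R

module Degree {c ℓ} (R : CommutativeRing c ℓ) where
  open CommutativeRing R renaming (Carrier to K) hiding (zero)
  open PolyOver R
  open Polynomial R

  record DegreeAtMost (p : Poly) (d : ℕ) : Set ℓ where
    constructor degreeAtMost
    field vanishes : ∀ n → d < n → coeff p n ≈ 0#
  open DegreeAtMost public

  record Degree (p : Poly) (d : ℕ) : Set ℓ where
    constructor degree
    field
      leading≉0 : ¬ coeff p d ≈ 0#
      atMost    : DegreeAtMost p d
  open Degree public

  DegreeAtMost-cong : ∀ {p q d} → p ≋ q → DegreeAtMost p d → DegreeAtMost q d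
  DegreeAtMost-cong (mk≋ e) (degreeAtMost v) = degreeAtMost λ n d<n → trans (sym (e n)) (v n d<n)

  Degree-cong : ∀ {p q d} → p ≋ q → Degree p d → Degree q d
  Degree-cong {d = d} (mk≋ e) (degree lead bound) =
    degree (λ z → lead (trans (e d) z)) (DegreeAtMost-cong (mk≋ e) bound)

  DegreeAtMost-mono : ∀ {p d e} → d ≤ e → DegreeAtMost p d → DegreeAtMost p e
  DegreeAtMost-mono d≤e (degreeAtMost v) = degreeAtMost λ n e<n → v n (ℕ.≤-<-trans d≤e e<n)

  DegreeAtMost-+ₚ : ∀ {p q d} → DegreeAtMost p d → DegreeAtMost q d → DegreeAtMost (p +ₚ q) d
  DegreeAtMost-+ₚ {p} {q} (degreeAtMost vp) (degreeAtMost vq) = degreeAtMost λ n d<n →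
    trans (coeff-+ₚ p q n) (trans (+-cong (vp n d<n) (vq n d<n)) (+-identityʳ 0#))

  DegreeAtMost-·ₚ : ∀ {a p d} → DegreeAtMost p d → DegreeAtMost (a ·ₚ p) d
  DegreeAtMost-·ₚ {a} {p} (degreeAtMost v) = degreeAtMost λ n d<n →
    trans (coeff-·ₚ a p n) (trans (*-congˡ (v n d<n)) (zeroʳ a))

  DegreeAtMost-constₚ : ∀ a → DegreeAtMost (constₚ a) 0
  DegreeAtMost-constₚ a = degreeAtMost λ { (suc n) _ → refl }

  DegreeAtMost-length : ∀ p → DegreeAtMost p (length p)
  DegreeAtMost-length p = degreeAtMost λ n len<n → reflexive (beyond p n (ℕ.<⇒≤ len<n))
    where
    beyond : ∀ p n → length p ≤ n → coeff p n ≡ 0#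
    beyond []      n       _           = ≡.refl
    beyond (a ∷ p) (suc n) (s≤s len≤n) = beyond p n len≤n

  Degree-+ₚˡ : ∀ {p q d e} → Degree p d → DegreeAtMost q e → e < d → Degree (p +ₚ q) d
  Degree-+ₚˡ {p} {q} {d} (degree lead bp) bq e<d = degree
    (λ z → lead (trans (sym (trans (+-congˡ (vanishes bq d e<d)) (+-identityʳ _)))
                       (trans (sym (coeff-+ₚ p q d)) z)))
    (DegreeAtMost-+ₚ bp (DegreeAtMost-mono (ℕ.<⇒≤ e<d) bq))

  Degree-+ₚʳ : ∀ {p q d e} → DegreeAtMost p e → Degree q d → e < d → Degree (p +ₚ q) d
  Degree-+ₚʳ {p} {q} bp dq e<d = Degree-cong (+ₚ-comm q p) (Degree-+ₚˡ dq bp e<d)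

  Degree-unique : ∀ {p d e} → Degree p d → Degree p e → d ≡ e
  Degree-unique {d = d} {e} (degree lead-d bound-d) (degree lead-e bound-e) with ℕ.<-cmp d e
  ... | tri< d<e _ _ = ⊥-elim (lead-e (vanishes bound-d e d<e))
  ... | tri≈ _ d≡e _ = d≡e
  ... | tri> _ _ e<d = ⊥-elim (lead-d (vanishes bound-e d e<d))

  Degree⇒≉0ₚ : ∀ {p d} → Degree p d → ¬ p ≋ 0ₚ
  Degree⇒≉0ₚ {d = d} (degree lead _) (mk≋ e) = lead (e d)

  DegreeAtMost-pred : ∀ {p d} → DegreeAtMost p (suc d) → coeff p (suc d) ≈ 0# → DegreeAtMost p d
  DegreeAtMost-pred {p} {d} (degreeAtMost v) top≈0 = degreeAtMost vanish
    where
    vanish : ∀ n → d < n → coeff p n ≈ 0#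
    vanish n d<n with ℕ.m≤n⇒m<n∨m≡n d<n
    ... | inj₁ 1+d<n  = v n 1+d<n
    ... | inj₂ ≡.refl = top≈0

  -- Equality of coefficients is not decidable, so a nonzero polynomial has a degree only up to ¬¬.
  degree-exists : ∀ {p} → ¬ p ≋ 0ₚ → DoubleNegation (∃ (Degree p))
  degree-exists {p} p≉0 = search (length p) (DegreeAtMost-length p)
    where
    search : ∀ d → DegreeAtMost p d → DoubleNegation (∃ (Degree p))
    search d bound ¬degree = ¬¬-excluded-middle (step d bound)
      where
      step : ∀ d → DegreeAtMost p d → ¬ Dec (coeff p d ≈ 0#)
      step d       bound (no top≉0)  = ¬degree (d , degree top≉0 bound)
      step zero    bound (yes top≈0) =
        p≉0 (mk≋ λ { zero → top≈0 ; (suc n) → vanishes bound (suc n) (s≤s z≤n) })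
      step (suc d) bound (yes top≈0) = search d (DegreeAtMost-pred bound top≈0) ¬degree

  coeff-∷-*ₚ : ∀ a p q k → coeff ((a ∷ p) *ₚ q) k ≈ a * coeff q k + coeff (shift (p *ₚ q)) k
  coeff-∷-*ₚ a p q k = trans (coeff-+ₚ (a ·ₚ q) (shift (p *ₚ q)) k) (+-congʳ (coeff-·ₚ a q k))

  *ₚ-top : ∀ p q {m n} → DegreeAtMost p m → DegreeAtMost q n →
           DegreeAtMost (p *ₚ q) (m ℕ.+ n) × coeff (p *ₚ q) (m ℕ.+ n) ≈ coeff p m * coeff q n
  *ₚ-top []      q             bp bq = degreeAtMost (λ _ _ → refl) , sym (zeroˡ _)
  *ₚ-top (a ∷ p) q {zero}  {n} bp bq = degreeAtMost bound , coeff≈ n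
    where
    shifted≋0 : shift (p *ₚ q) ≋ 0ₚ
    shifted≋0 = ≋-trans (shift-cong (*ₚ-zeroˡ p q (mk≋ λ k → vanishes bp (suc k) (s≤s z≤n)))) shift-0ₚ
    coeff≈ : ∀ k → coeff ((a ∷ p) *ₚ q) k ≈ a * coeff q k
    coeff≈ k = trans (coeff-∷-*ₚ a p q k) (trans (+-congˡ (coeff-≈ shifted≋0 k)) (+-identityʳ _))
    bound : ∀ k → n < k → coeff ((a ∷ p) *ₚ q) k ≈ 0#
    bound k n<k = trans (coeff≈ k) (trans (*-congˡ (vanishes bq k n<k)) (zeroʳ a))
  *ₚ-top (a ∷ p) q {suc m} {n} bp bq = degreeAtMost bound , top
    where
    ih = *ₚ-top p q (degreeAtMost λ k m<k → vanishes bp (suc k) (s≤s m<k)) bq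
    a*q≈0 : ∀ k → n ≤ k → a * coeff q (suc k) ≈ 0#
    a*q≈0 k n≤k = trans (*-congˡ (vanishes bq (suc k) (s≤s n≤k))) (zeroʳ a)
    bound : ∀ k → suc m ℕ.+ n < k → coeff ((a ∷ p) *ₚ q) k ≈ 0#
    bound (suc k) (s≤s m+n<k) = trans (coeff-∷-*ₚ a p q (suc k))
      (trans (+-cong (a*q≈0 k (ℕ.≤-trans (ℕ.m≤n+m n m) (ℕ.<⇒≤ m+n<k))) (vanishes (proj₁ ih) k m+n<k)) (+-identityʳ 0#))
    top : coeff ((a ∷ p) *ₚ q) (suc m ℕ.+ n) ≈ coeff p m * coeff q n
    top = trans (coeff-∷-*ₚ a p q (suc (m ℕ.+ n)))
      (trans (+-cong (a*q≈0 (m ℕ.+ n) (ℕ.m≤n+m n m)) (proj₂ ih)) (+-identityˡ _))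

  DegreeAtMost-*ₚ : ∀ {p q m n} → DegreeAtMost p m → DegreeAtMost q n → DegreeAtMost (p *ₚ q) (m ℕ.+ n)
  DegreeAtMost-*ₚ {p} {q} bp bq = proj₁ (*ₚ-top p q bp bq)

  module _ (no-zero-divisors : NoZeroDivisors R) where

    Degree-·ₚ : ∀ {a p d} → ¬ a ≈ 0# → Degree p d → Degree (a ·ₚ p) d
    Degree-·ₚ {a} {p} {d} a≉0 (degree lead bound) =
      degree (λ z → no-zero-divisors a≉0 lead (trans (sym (coeff-·ₚ a p d)) z)) (DegreeAtMost-·ₚ bound)

    Degree-*ₚ : ∀ {p q m n} → Degree p m → Degree q n → Degree (p *ₚ q) (m ℕ.+ n)
    Degree-*ₚ {p} {q} (degree lead-p bp) (degree lead-q bq) =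
      degree (λ z → no-zero-divisors lead-p lead-q (trans (sym (proj₂ (*ₚ-top p q bp bq))) z))
             (proj₁ (*ₚ-top p q bp bq))

    Degree-∣ₚ : ∀ {y p d e} → Degree y d → Degree p e → y ∣ₚ p → d ≤ e
    Degree-∣ₚ {y} {p} {d} {e} Dy Dp (r , p≈r*y) = decidable-stable (d ℕ.≤? e) λ d≰e →
      degree-exists r≉0 λ (s , Dr) → d≰e (ℕ.≤-trans (ℕ.m≤n+m d s) (ℕ.≤-reflexive (Degree-unique (Degree-*ₚ Dr Dy) Dp′)))
      where
      Dp′ : Degree (r *ₚ y) e
      Dp′ = Degree-cong (mk≋ p≈r*y) Dp
      r≉0 : ¬ r ≋ 0ₚ
      r≉0 r≋0 = Degree⇒≉0ₚ Dp′ (*ₚ-zeroˡ r y r≋0)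

module Derivative {c ℓ} (R : CommutativeRing c ℓ) where
  open CommutativeRing R renaming (Carrier to K) hiding (zero)
  open PolyOver R
  open Polynomial R
  open Degree R
  open PolySolver using (solve; _:=_; _:+_)

  -- (a + t·p)′ = p + t·p′
  ∂ : Poly → Poly
  ∂ []      = []
  ∂ (a ∷ p) = p +ₚ shift (∂ p)

  coeff-∂ : ∀ p n → coeff (∂ p) n ≈ fromℕ R (suc n) * coeff p (suc n)
  coeff-∂ []      n       = sym (zeroʳ _)
  coeff-∂ (a ∷ p) zero    = trans (coeff-+ₚ p (shift (∂ p)) 0)
    (trans (+-identityʳ _) (sym (trans (*-congʳ (+-identityʳ 1#)) (*-identityˡ _))))
  coeff-∂ (a ∷ p) (suc n) = trans (coeff-+ₚ p (shift (∂ p)) (suc n))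
    (trans (+-cong (sym (*-identityˡ _)) (coeff-∂ p n)) (sym (distribʳ _ 1# (fromℕ R (suc n)))))

  ∂-cong : ∀ {p q} → p ≋ q → ∂ p ≋ ∂ q
  ∂-cong {p} {q} (mk≋ e) = mk≋ λ n →
    trans (coeff-∂ p n) (trans (*-congˡ (e (suc n))) (sym (coeff-∂ q n)))

  ∂-+ₚ : ∀ p q → ∂ (p +ₚ q) ≋ ∂ p +ₚ ∂ q
  ∂-+ₚ p q = mk≋ λ n → begin
    coeff (∂ (p +ₚ q)) n                          ≈⟨ trans (coeff-∂ (p +ₚ q) n) (*-congˡ (coeff-+ₚ p q (suc n))) ⟩
    fromℕ R (suc n) * (coeff p (suc n) + coeff q (suc n)) ≈⟨ distribˡ _ _ _ ⟩
    fromℕ R (suc n) * coeff p (suc n) + fromℕ R (suc n) * coeff q (suc n)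
      ≈⟨ trans (coeff-+ₚ (∂ p) (∂ q) n) (+-cong (coeff-∂ p n) (coeff-∂ q n)) ⟨
    coeff (∂ p +ₚ ∂ q) n                          ∎
    where open import Relation.Binary.Reasoning.Setoid setoid

  ∂-·ₚ : ∀ a p → ∂ (a ·ₚ p) ≋ a ·ₚ ∂ p
  ∂-·ₚ a p = mk≋ λ n → begin
    coeff (∂ (a ·ₚ p)) n                   ≈⟨ trans (coeff-∂ (a ·ₚ p) n) (*-congˡ (coeff-·ₚ a p (suc n))) ⟩
    fromℕ R (suc n) * (a * coeff p (suc n)) ≈⟨ x∙yz≈y∙xz _ _ _ ⟩
    a * (fromℕ R (suc n) * coeff p (suc n)) ≈⟨ trans (coeff-·ₚ a (∂ p) n) (*-congˡ (coeff-∂ p n)) ⟨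
    coeff (a ·ₚ ∂ p) n                     ∎
    where open import Relation.Binary.Reasoning.Setoid setoid
          open import Algebra.Properties.CommutativeSemigroup *-commutativeSemigroup using (x∙yz≈y∙xz)

  ∂--ₚ : ∀ p q → ∂ (p -ₚ q) ≋ ∂ p -ₚ ∂ q
  ∂--ₚ p q = ≋-trans (∂-+ₚ p (-ₚ q)) (+ₚ-cong ≋-refl (∂-·ₚ (- 1#) q))

  ∂-*ₚ : ∀ p q → ∂ (p *ₚ q) ≋ ∂ p *ₚ q +ₚ p *ₚ ∂ q
  ∂-*ₚ []      q = ≋-refl
  ∂-*ₚ (a ∷ p) q = begin
    ∂ (a ·ₚ q +ₚ shift (p *ₚ q))
      ≈⟨ ∂-+ₚ (a ·ₚ q) (shift (p *ₚ q)) ⟩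
    ∂ (a ·ₚ q) +ₚ (p *ₚ q +ₚ shift (∂ (p *ₚ q)))
      ≈⟨ +ₚ-cong (∂-·ₚ a q) (+ₚ-cong ≋-refl (≋-trans (shift-cong (∂-*ₚ p q)) (shift-+ₚ (∂ p *ₚ q) (p *ₚ ∂ q)))) ⟩
    a ·ₚ ∂ q +ₚ (p *ₚ q +ₚ (shift (∂ p *ₚ q) +ₚ shift (p *ₚ ∂ q)))
      ≈⟨ solve 4 (λ A B C D → A :+ (B :+ (C :+ D)) := (B :+ C) :+ (A :+ D)) ≋-refl
           (a ·ₚ ∂ q) (p *ₚ q) (shift (∂ p *ₚ q)) (shift (p *ₚ ∂ q)) ⟩
    (p *ₚ q +ₚ shift (∂ p *ₚ q)) +ₚ (a ·ₚ ∂ q +ₚ shift (p *ₚ ∂ q))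
      ≈⟨ +ₚ-cong (+ₚ-cong (≋-refl {p *ₚ q}) (shift-*ₚ (∂ p) q)) (≋-refl {a ·ₚ ∂ q +ₚ shift (p *ₚ ∂ q)}) ⟨
    (p *ₚ q +ₚ shift (∂ p) *ₚ q) +ₚ (a ·ₚ ∂ q +ₚ shift (p *ₚ ∂ q))
      ≈⟨ +ₚ-cong (*ₚ-distribʳ q p (shift (∂ p))) (≋-refl {a ·ₚ ∂ q +ₚ shift (p *ₚ ∂ q)}) ⟨
    ∂ (a ∷ p) *ₚ q +ₚ (a ∷ p) *ₚ ∂ q ∎
    where open ≋-Reasoning

  ∂-numeral : ∀ n → ∂ (numeral n) ≋ 0ₚ
  ∂-numeral zero    = ≋-refl
  ∂-numeral (suc n) = ≋-trans (∂-+ₚ 1ₚ (numeral n)) (+ₚ-cong shift-0ₚ (∂-numeral n))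

  ∂-numeral-*ₚ : ∀ n p → ∂ (numeral n *ₚ p) ≋ numeral n *ₚ ∂ p
  ∂-numeral-*ₚ n p = ≋-trans (∂-*ₚ (numeral n) p) (+ₚ-cong (*ₚ-zeroˡ _ p (∂-numeral n)) ≋-refl)

  Degree-∂ : NoZeroDivisors R → CharZero R → ∀ {p d} → Degree p (suc d) → Degree (∂ p) d
  Degree-∂ no-zero-divisors char0 {p} {d} (degree lead bound) = degree
    (λ z → no-zero-divisors (char0 d) lead (trans (sym (coeff-∂ p d)) z))
    (degreeAtMost λ n d<n → trans (coeff-∂ p n) (trans (*-congˡ (vanishes bound (suc n) (s≤s d<n))) (zeroʳ _)))

double≡triple-suc⇒< : ∀ {m n} → m ℕ.+ m ≡ suc n ℕ.+ suc n ℕ.+ suc n → n < m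
double≡triple-suc⇒< {m} {n} eq = ℕ.≰⇒> λ m≤n → ℕ.<-irrefl eq (begin-strict
  m ℕ.+ m                       ≤⟨ ℕ.+-mono-≤ m≤n m≤n ⟩
  n ℕ.+ n                       <⟨ ℕ.+-mono-< (ℕ.n<1+n n) (ℕ.n<1+n n) ⟩
  suc n ℕ.+ suc n               ≤⟨ ℕ.m≤m+n _ _ ⟩
  suc n ℕ.+ suc n ℕ.+ suc n     ∎)
  where open ℕ.≤-Reasoning

module CurvePoints {c ℓ} (R : CommutativeRing c ℓ)
    (no-zero-divisors : NoZeroDivisors R) (char0 : CharZero R) where
  open CommutativeRing R renaming (Carrier to K) hiding (zero)
  open PolyOver R
  open Polynomial R
  open Degree R
  open Derivative R
  open PythagoreanReduction polyRing using (OnCurve)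
  open PolySolver using (solve; _:=_; _:+_; _:*_; _:-_; con)
  open ≋-Reasoning

  cubic : Poly → Poly
  cubic v = numeral 1 +ₚ numeral 4 *ₚ (v *ₚ v) -ₚ numeral 4 *ₚ (v *ₚ v *ₚ v)

  completed-square : ∀ u v → OnCurve u v →
    (numeral 2 *ₚ u -ₚ numeral 1) *ₚ (numeral 2 *ₚ u -ₚ numeral 1) ≋ cubic v
  completed-square u v onCurve = begin
    (numeral 2 *ₚ u -ₚ numeral 1) *ₚ (numeral 2 *ₚ u -ₚ numeral 1)
      ≈⟨ solve 1 (λ u → (con (+ 2) :* u :- con (+ 1)) :* (con (+ 2) :* u :- con (+ 1)) :=
                         con (+ 4) :* (u :* u :- u) :+ con (+ 1)) ≋-refl u ⟩
    numeral 4 *ₚ (u *ₚ u -ₚ u) +ₚ numeral 1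
      ≈⟨ +ₚ-cong (*ₚ-congʳ (numeral 4) onCurve) (≋-refl {numeral 1}) ⟩
    numeral 4 *ₚ (v *ₚ v -ₚ v *ₚ v *ₚ v) +ₚ numeral 1
      ≈⟨ solve 1 (λ v → con (+ 4) :* (v :* v :- v :* v :* v) :+ con (+ 1) :=
                         con (+ 1) :+ con (+ 4) :* (v :* v) :- con (+ 4) :* (v :* v :* v)) ≋-refl v ⟩
    cubic v ∎

  -- The cofactors come from (43 − 24v)·S + (3 − 17v + 8v²)·S′ = 43 for S = 1 + 4v² − 4v³:
  -- differentiating y² = S(v) then exhibits y as a factor of 43·v′.
  ∣ₚ-43∂ : ∀ y v → y *ₚ y ≋ cubic v → y ∣ₚ numeral 43 *ₚ ∂ v
  ∣ₚ-43∂ y v y²≋S = (a *ₚ y) *ₚ ∂ v +ₚ b *ₚ (∂ y +ₚ ∂ y) , coeff-≈ (begin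
    numeral 43 *ₚ ∂ v
      ≈⟨ solve 2 (λ v v′ → con (+ 43) :* v′ :=
           ((con (+ 43) :- con (+ 24) :* v) :* (con (+ 1) :+ con (+ 4) :* (v :* v) :- con (+ 4) :* (v :* v :* v))) :* v′
           :+ (con (+ 3) :- con (+ 17) :* v :+ con (+ 8) :* (v :* v)) :*
              (con (+ 4) :* (v′ :* v :+ v :* v′) :- con (+ 4) :* ((v′ :* v :+ v :* v′) :* v :+ (v :* v) :* v′)))
           ≋-refl v (∂ v) ⟩
    (a *ₚ cubic v) *ₚ ∂ v +ₚ b *ₚ S′
      ≈⟨ +ₚ-cong (*ₚ-congˡ _ _ (∂ v) (*ₚ-congʳ a (≋-sym y²≋S))) (*ₚ-congʳ b (≋-sym ∂y²≋S′)) ⟩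
    (a *ₚ (y *ₚ y)) *ₚ ∂ v +ₚ b *ₚ (∂ y *ₚ y +ₚ y *ₚ ∂ y)
      ≈⟨ solve 4 (λ v v′ y y′ →
           ((con (+ 43) :- con (+ 24) :* v) :* (y :* y)) :* v′ :+ (con (+ 3) :- con (+ 17) :* v :+ con (+ 8) :* (v :* v)) :* (y′ :* y :+ y :* y′)
           := (((con (+ 43) :- con (+ 24) :* v) :* y) :* v′ :+ (con (+ 3) :- con (+ 17) :* v :+ con (+ 8) :* (v :* v)) :* (y′ :+ y′)) :* y)
           ≋-refl v (∂ v) y (∂ y) ⟩
    ((a *ₚ y) *ₚ ∂ v +ₚ b *ₚ (∂ y +ₚ ∂ y)) *ₚ y ∎)
    where
    a = numeral 43 -ₚ numeral 24 *ₚ v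
    b = numeral 3 -ₚ numeral 17 *ₚ v +ₚ numeral 8 *ₚ (v *ₚ v)
    S′ = numeral 4 *ₚ (∂ v *ₚ v +ₚ v *ₚ ∂ v) -ₚ numeral 4 *ₚ ((∂ v *ₚ v +ₚ v *ₚ ∂ v) *ₚ v +ₚ (v *ₚ v) *ₚ ∂ v)
    ∂S≋S′ : ∂ (cubic v) ≋ S′
    ∂S≋S′ = begin
      ∂ (cubic v)
        ≈⟨ ∂--ₚ (numeral 1 +ₚ numeral 4 *ₚ (v *ₚ v)) (numeral 4 *ₚ (v *ₚ v *ₚ v)) ⟩
      ∂ (numeral 1 +ₚ numeral 4 *ₚ (v *ₚ v)) -ₚ ∂ (numeral 4 *ₚ (v *ₚ v *ₚ v))
        ≈⟨ +ₚ-cong (≋-trans (∂-+ₚ (numeral 1) (numeral 4 *ₚ (v *ₚ v))) (+ₚ-cong (∂-numeral 1) (∂-numeral-*ₚ 4 (v *ₚ v))))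
                   (-ₚ-cong (∂-numeral-*ₚ 4 (v *ₚ v *ₚ v))) ⟩
      numeral 4 *ₚ ∂ (v *ₚ v) -ₚ numeral 4 *ₚ ∂ (v *ₚ v *ₚ v)
        ≈⟨ +ₚ-cong (*ₚ-congʳ (numeral 4) (∂-*ₚ v v))
                   (-ₚ-cong (*ₚ-congʳ (numeral 4) (≋-trans (∂-*ₚ (v *ₚ v) v) (+ₚ-cong (*ₚ-congˡ _ _ v (∂-*ₚ v v)) ≋-refl)))) ⟩
      S′ ∎
    ∂y²≋S′ : ∂ y *ₚ y +ₚ y *ₚ ∂ y ≋ S′
    ∂y²≋S′ = ≋-trans (≋-sym (∂-*ₚ y y)) (≋-trans (∂-cong y²≋S) ∂S≋S′)

  -1≉0 : ¬ - 1# ≈ 0#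
  -1≉0 -1≈0 = char0 0 (trans (+-congˡ (sym -1≈0)) (-‿inverseʳ 1#))

  Degree-square-minus-self : ∀ {u d} → Degree u d → 1 ≤ d → Degree (u *ₚ u -ₚ u) (d ℕ.+ d)
  Degree-square-minus-self Du 1≤d =
    Degree-+ₚˡ (Degree-*ₚ no-zero-divisors Du Du) (DegreeAtMost-·ₚ (atMost Du)) (ℕ.m<m+n _ 1≤d)

  Degree-square-minus-cube : ∀ {v d} → Degree v d → 1 ≤ d → Degree (v *ₚ v -ₚ v *ₚ v *ₚ v) (d ℕ.+ d ℕ.+ d)
  Degree-square-minus-cube Dv 1≤d = Degree-+ₚʳ (DegreeAtMost-*ₚ (atMost Dv) (atMost Dv))
    (Degree-·ₚ no-zero-divisors -1≉0 (Degree-*ₚ no-zero-divisors (Degree-*ₚ no-zero-divisors Dv Dv) Dv))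
    (ℕ.m<m+n _ 1≤d)

  DegreeAtMost-square-minus-cube : ∀ {v} → DegreeAtMost v 0 → DegreeAtMost (v *ₚ v -ₚ v *ₚ v *ₚ v) 0
  DegreeAtMost-square-minus-cube b =
    DegreeAtMost-+ₚ (DegreeAtMost-*ₚ b b) (DegreeAtMost-·ₚ (DegreeAtMost-*ₚ (DegreeAtMost-*ₚ b b) b))

  Degree-completed-square : ∀ {u d} → Degree u d → 1 ≤ d → Degree (numeral 2 *ₚ u -ₚ numeral 1) d
  Degree-completed-square Du 1≤d = Degree-+ₚˡ
    (Degree-cong (≋-sym (numeral-*ₚ 2 _)) (Degree-·ₚ no-zero-divisors (char0 1) Du))
    (DegreeAtMost-·ₚ (DegreeAtMost-constₚ 1#)) 1≤d

  Degree-43∂ : ∀ {v e} → Degree v (suc e) → Degree (numeral 43 *ₚ ∂ v) e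
  Degree-43∂ Dv = Degree-cong (≋-sym (numeral-*ₚ 43 _))
    (Degree-·ₚ no-zero-divisors (char0 42) (Degree-∂ no-zero-divisors char0 Dv))

  no-nonconstant-point : ∀ {u d} → Degree u d → 1 ≤ d → ∀ v → ¬ OnCurve u v
  no-nonconstant-point {u} {d} Du 1≤d v onCurve = degree-exists v≉0 λ where
      (zero  , Dv) → v-nonconstant (atMost Dv)
      (suc e , Dv) → ℕ.<⇒≱ (double≡triple-suc⇒< (Degree-unique Dcurve (Degree-square-minus-cube Dv (s≤s z≤n))))
        (Degree-∣ₚ no-zero-divisors (Degree-completed-square Du 1≤d) (Degree-43∂ Dv)
          (∣ₚ-43∂ _ v (completed-square u v onCurve)))
    where
    Dcurve : Degree (v *ₚ v -ₚ v *ₚ v *ₚ v) (d ℕ.+ d)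
    Dcurve = Degree-cong onCurve (Degree-square-minus-self Du 1≤d)
    v-nonconstant : ¬ DegreeAtMost v 0
    v-nonconstant b = leading≉0 Dcurve
      (vanishes (DegreeAtMost-square-minus-cube b) _ (ℕ.<-≤-trans 1≤d (ℕ.m≤m+n d d)))
    v≉0 : ¬ v ≋ 0ₚ
    v≉0 v≋0 = v-nonconstant (DegreeAtMost-cong (≋-sym v≋0) (degreeAtMost λ _ _ → refl))

  no-nonconstant-multiple-point : ∀ {w A} → ¬ w ≋ 0ₚ → Nonconstant A → ∀ v → ¬ OnCurve (w *ₚ A) v
  no-nonconstant-multiple-point w≉0 (d , (lead , bound) , 1≤d) v onCurve = degree-exists w≉0 λ (e , Dw) →
    no-nonconstant-point (Degree-*ₚ no-zero-divisors Dw (degree lead (degreeAtMost bound)))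
      (ℕ.≤-trans 1≤d (ℕ.m≤n+m d e)) v onCurve

field⇒noZeroDivisors : ∀ {c ℓ} (R : CommutativeRing c ℓ) → IsField R → NoZeroDivisors R
field⇒noZeroDivisors R (_ , inverse) {a} {b} a≉0 b≉0 ab≈0 with inverse a a≉0
... | a⁻¹ , aa⁻¹≈1 = b≉0 (begin
  b              ≈⟨ *-identityˡ b ⟨
  1# * b         ≈⟨ *-congʳ aa⁻¹≈1 ⟨
  (a * a⁻¹) * b  ≈⟨ *-congʳ (*-comm a a⁻¹) ⟩
  (a⁻¹ * a) * b  ≈⟨ *-assoc a⁻¹ a b ⟩
  a⁻¹ * (a * b)  ≈⟨ *-congˡ ab≈0 ⟩
  a⁻¹ * 0#       ≈⟨ zeroʳ a⁻¹ ⟩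
  0#             ∎)
  where
  open CommutativeRing R
  open import Relation.Binary.Reasoning.Setoid setoid

lemma3p2 : ∀ {c ℓ} (K : CommutativeRing c ℓ) → IsField K → CharZero K → AlgClosed K →
    let open PolyOver K in
    (f g w : Poly) → RelativelyPrime f g → (s : Bool) → ¬ (w ≈ₚ 0ₚ) →
    let (A , B , C) = triple s f g in
    (NonconstantEvenDegree A → ¬ (w *ₚ A +ₚ (w *ₚ B) ^ₚ 2 ≈ₚ (w *ₚ C) ^ₚ 3))
    × (NonconstantEvenDegree C → ¬ ((w *ₚ A) ^ₚ 2 +ₚ (w *ₚ B) ^ₚ 3 ≈ₚ w *ₚ C))
lemma3p2 K isField char0 _ f g w _ s w≉0 =
    (λ A-even eq → no-nonconstant-multiple-point w≉0′ (nonconstant A A-even) (w *ₚ C)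
                     (onCurve-from-first w A B C pythagorean (first-equation eq)))
  , (λ C-even eq → no-nonconstant-multiple-point w≉0′ (nonconstant C C-even) (w *ₚ B)
                     (onCurve-from-second w A B C pythagorean (second-equation eq)))
  where
  open PolyOver K
  open Polynomial K
  open PythagoreanTriple K
  open PythagoreanReduction polyRing
  open CurvePoints K (field⇒noZeroDivisors K isField) char0
  A = proj₁ (triple s f g)
  B = proj₁ (proj₂ (triple s f g))
  C = proj₂ (proj₂ (triple s f g))
  pythagorean : A *ₚ A +ₚ B *ₚ B ≋ C *ₚ C
  pythagorean = triple-pythagorean s f g
  w≉0′ : ¬ w ≋ 0ₚ
  w≉0′ w≋0 = w≉0 (coeff-≈ w≋0)
  nonconstant : ∀ p → NonconstantEvenDegree p → Nonconstant p
  nonconstant _ (d , hd , 1≤d , _) = d , hd , 1≤d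
  first-equation : w *ₚ A +ₚ (w *ₚ B) ^ₚ 2 ≈ₚ (w *ₚ C) ^ₚ 3 →
                   w *ₚ A +ₚ (w *ₚ B) *ₚ (w *ₚ B) ≋ (w *ₚ C) *ₚ ((w *ₚ C) *ₚ (w *ₚ C))
  first-equation eq = ≋-trans (+ₚ-cong (≋-refl {w *ₚ A}) (≋-sym (^ₚ-2 (w *ₚ B)))) (≋-trans (mk≋ eq) (^ₚ-3 (w *ₚ C)))
  second-equation : (w *ₚ A) ^ₚ 2 +ₚ (w *ₚ B) ^ₚ 3 ≈ₚ w *ₚ C →
                    (w *ₚ A) *ₚ (w *ₚ A) +ₚ (w *ₚ B) *ₚ ((w *ₚ B) *ₚ (w *ₚ B)) ≋ w *ₚ C
  second-equation eq = ≋-trans (+ₚ-cong (≋-sym (^ₚ-2 (w *ₚ A))) (≋-sym (^ₚ-3 (w *ₚ B)))) (mk≋ eq)
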